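{- If $G$ is a semiregular bipartite graph, then $g: {\mathbb Z}^{E_{\operatorname{line} G}} \rightarrow {\mathbb Z}^{E_G}$ is a morphism of the associated rational orthogonal decompositions, and hence induces a group homomorphism $g: K(\operatorname{line} G) \rightarrow K(G)$.
   Context: $G$ is simple, bipartite with parts $V_1,V_2$, all vertices in $V_i$ of degree $d_i$; $\lambda=\lcm(d_1,d_2)$; $a$'s denote vertices in $V_1$ and $b$'s vertices in $V_2$. $\operatorname{line} G$ is the line graph of $G$ and $K(\cdot)$ the critical group. The map $g$ is defined linearly by $g(ab,ba')=\frac{\lambda}{d_2}((a,b)+(b,a'))$ and $g(ba,ab')=\frac{\lambda}{d_1}((b,a)+(a,b'))$. A morphism of rational orthogonal decompositions is an integral linear map $f$ with $f(B_1)\subset B_2$ and $f(Z_1)\subset Z_2$ (bond and cycle lattices). -}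

module Defs where

open import Data.Bool using (Bool; true; false; _∧_; _∨_; not; if_then_else_)
open import Data.Nat as ℕ using (ℕ; NonZero)
open import Data.Nat.LCM using (lcm)
open import Data.Nat.DivMod using (_/_)
open import Data.Fin using (Fin)
open import Data.Fin.Properties using () renaming (_≟_ to _≟ᶠ_)
open import Data.Integer using (ℤ; +_; _+_; _-_; _*_; -_)
open import Data.List using (List; []; _∷_; map; foldr; _++_; allFin; filterᵇ; cartesianProduct; length)
open import Data.Product using (_×_; _,_; ∃; Σ-syntax)
open import Data.Sum using (_⊎_; inj₁; inj₂)
open import Relation.Nullary using (does)
open import Relation.Binary.PropositionalEquality using (_≡_)

-- A finite graph: vertex type, a duplicate-free list of all vertices,
-- and a (symmetric, irreflexive) Boolean adjacency relation.
record Graph : Set₁ where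
  field
    V     : Set
    verts : List V
    adj   : V → V → Bool
open Graph public

sumℤ : List ℤ → ℤ
sumℤ = foldr _+_ (+ 0)

-- ℤ^{E_Γ}: integer functions on oriented edges with c(v,u) = - c(u,v),
-- represented as functions on ordered vertex pairs vanishing off edges.
Chain : Graph → Set
Chain Γ = V Γ → V Γ → ℤ

IsChain : (Γ : Graph) → Chain Γ → Set
IsChain Γ c = (∀ u v → c u v ≡ - c v u) × (∀ u v → adj Γ u v ≡ false → c u v ≡ + 0)

InBond : (Γ : Graph) → Chain Γ → Set
InBond Γ c = IsChain Γ c ×
  ∃ λ (φ : V Γ → ℤ) → ∀ u v → adj Γ u v ≡ true → c u v ≡ φ v - φ u

InCycle : (Γ : Graph) → Chain Γ → Set
InCycle Γ c = IsChain Γ c × (∀ v → sumℤ (map (λ u → c u v) (verts Γ)) ≡ + 0)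

-- B ⊕ Z, the subgroup with K(Γ) = ℤ^{E_Γ} / (B ⊕ Z).
InBondPlusCycle : (Γ : Graph) → Chain Γ → Set
InBondPlusCycle Γ c = Σ[ b ∈ Chain Γ ] Σ[ z ∈ Chain Γ ]
  InBond Γ b × InCycle Γ z × (∀ u v → c u v ≡ b u v + z u v)

-- Simple bipartite graphs given by a biadjacency relation
-- V₁ = Fin p (the a's), V₂ = Fin q (the b's).

BiAdj : ℕ → ℕ → Set
BiAdj p q = Fin p → Fin q → Bool

eqᶠ : ∀ {n} → Fin n → Fin n → Bool
eqᶠ i j = does (i ≟ᶠ j)

bipAdj : ∀ {p q} → BiAdj p q → Fin p ⊎ Fin q → Fin p ⊎ Fin q → Bool
bipAdj A (inj₁ a) (inj₂ b) = A a b
bipAdj A (inj₂ b) (inj₁ a) = A a b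
bipAdj A _ _ = false

bipGraph : ∀ {p q} → BiAdj p q → Graph
bipGraph {p} {q} A = record
  { V = Fin p ⊎ Fin q
  ; verts = map inj₁ (allFin p) ++ map inj₂ (allFin q)
  ; adj = bipAdj A }

deg₁ : ∀ {p q} → BiAdj p q → Fin p → ℕ
deg₁ {p} {q} A a = length (filterᵇ (A a) (allFin q))

deg₂ : ∀ {p q} → BiAdj p q → Fin q → ℕ
deg₂ {p} {q} A b = length (filterᵇ (λ a → A a b) (allFin p))

Semiregular : ∀ {p q} → BiAdj p q → ℕ → ℕ → Set
Semiregular {p} {q} A d₁ d₂ = (∀ a → deg₁ A a ≡ d₁) × (∀ b → deg₂ A b ≡ d₂)

lineAdj : ∀ {p q} → BiAdj p q → Fin p × Fin q → Fin p × Fin q → Bool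
lineAdj A (a , b) (a' , b') =
  A a b ∧ A a' b' ∧ ((eqᶠ a a' ∧ not (eqᶠ b b')) ∨ (not (eqᶠ a a') ∧ eqᶠ b b'))

lineGraph : ∀ {p q} → BiAdj p q → Graph
lineGraph {p} {q} A = record
  { V = Fin p × Fin q
  ; verts = filterᵇ (λ { (a , b) → A a b }) (cartesianProduct (allFin p) (allFin q))
  ; adj = lineAdj A }

eqV : ∀ {p q} → Fin p ⊎ Fin q → Fin p ⊎ Fin q → Bool
eqV (inj₁ a) (inj₁ a') = eqᶠ a a'
eqV (inj₂ b) (inj₂ b') = eqᶠ b b'
eqV _ _ = false

edgeChain : ∀ {p q} → Fin p ⊎ Fin q → Fin p ⊎ Fin q → Fin p ⊎ Fin q → Fin p ⊎ Fin q → ℤ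
edgeChain u v x y =
  (if eqV u x ∧ eqV v y then + 1 else + 0) - (if eqV v x ∧ eqV u y then + 1 else + 0)

gEdge : ∀ {p q} → (A : BiAdj p q) → (d₁ d₂ : ℕ) → .{{_ : NonZero d₁}} → .{{_ : NonZero d₂}} →
        Fin p × Fin q → Fin p × Fin q → Chain (bipGraph A)
gEdge A d₁ d₂ (a , b) (a' , b') x y =
  if lineAdj A (a , b) (a' , b')
  then (if eqᶠ b b'
        then + (lcm d₁ d₂ / d₂) * (edgeChain (inj₁ a) (inj₂ b) x y + edgeChain (inj₂ b) (inj₁ a') x y)
        else + (lcm d₁ d₂ / d₁) * (edgeChain (inj₂ b) (inj₁ a) x y + edgeChain (inj₁ a) (inj₂ b') x y))
  else + 0

orderedPairs : ∀ {X : Set} → List X → List (X × X)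
orderedPairs [] = []
orderedPairs (x ∷ xs) = map (x ,_) xs ++ orderedPairs xs

-- Linear extension: one orientation (e , e') per edge of line G is a ℤ-basis of
-- ℤ^{E_{line G}}, and g c = Σ c(e,e') g(e,e') over that basis.
gMap : ∀ {p q} → (A : BiAdj p q) → (d₁ d₂ : ℕ) → .{{_ : NonZero d₁}} → .{{_ : NonZero d₂}} →
       Chain (lineGraph A) → Chain (bipGraph A)
gMap A d₁ d₂ c x y =
  sumℤ (map (λ { (e , e') → c e e' * gEdge A d₁ d₂ e e' x y })
            (orderedPairs (verts (lineGraph A))))

-- Identify a vertex e = ab of line G with the oriented edge a → b of G.  Then
-- g(e, e') = κ(e, e')·(e − e'), where κ = λ/d₂ if e and e' share their b-end and κ = −λ/d₁ if they
-- share their a-end, so for an antisymmetric c the value of g c on a → b is Σₑ c(ab, e)·κ(ab, e).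
-- If c is a cycle, its outflow at ab vanishes, which leaves (λ/d₁ + λ/d₂) times the flow of c
-- inside the star of b (equivalently, minus it times the flow inside the star of a); summed over a
-- star of G this is a double sum of an antisymmetric function, hence 0.  If c = δφ, the sum splits
-- into the two stars through ab and equals (λ/d₂)(Φ(b) − d₂φ(ab)) − (λ/d₁)(Φ(a) − d₁φ(ab)), with
-- Φ(v) the sum of φ over the edges at v; the φ(ab) terms cancel because (λ/d₁)d₁ = λ = (λ/d₂)d₂,
-- so g δφ = δψ for ψ(a) = (λ/d₁)Φ(a), ψ(b) = (λ/d₂)Φ(b).
module Submission where

open import Defs
open import Data.Nat using (ℕ; NonZero)
open import Data.Integer using (_+_)
open import Data.Product using (_×_)
open import Relation.Binary.PropositionalEquality using (_≡_)

open import Data.Bool using (Bool; true; false; _∧_; not; if_then_else_)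
open import Data.Bool.Properties using (∧-comm; ∧-zeroʳ; not-injective)
open import Data.Empty using (⊥)
open import Data.Fin using (Fin; zero; suc)
open import Data.Fin.Properties using () renaming (_≟_ to _≟ᶠ_)
open import Data.Integer using (ℤ; +_; -[1+_]; -_; _-_; _*_)
open import Data.Integer.Properties
  using (*-zeroʳ; *-identityˡ; *-identityʳ; +-identityˡ; +-identityʳ; +-inverseʳ; +-assoc; *-assoc; *-comm;
         *-distribˡ-+; *-distribʳ-+; neg-distrib-+; neg-distribˡ-*; neg-distribʳ-*; pos-*;
         +-commutativeSemigroup; *-commutativeSemigroup)
open import Algebra.Properties.CommutativeSemigroup +-commutativeSemigroup using (interchange)
open import Algebra.Properties.CommutativeSemigroup *-commutativeSemigroup using (x∙yz≈y∙xz)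
open import Data.Integer.Tactic.RingSolver using (solve-∀)
open import Data.List using (List; []; _∷_; map; _++_; allFin; filterᵇ; cartesianProduct; length)
open import Data.List.Properties using (map-tabulate)
import Data.Nat as ℕ
open import Data.Nat.DivMod using (_/_; m/n*n≡m)
open import Data.Nat.LCM using (lcm; m∣lcm[m,n]; n∣lcm[m,n])
open import Data.Product using (_,_; proj₁; proj₂; uncurry)
open import Data.Sum using (_⊎_; inj₁; inj₂)
open import Function using (_∘_; flip)
open import Relation.Nullary using (yes; no)
open import Relation.Nullary.Decidable using (dec-true; dec-false)
open import Relation.Binary.PropositionalEquality using (refl; sym; trans; cong; cong₂; module ≡-Reasoning)
open ≡-Reasoning

𝟙 : Bool → ℤ
𝟙 b = if b then + 1 else + 0

𝟙-∧-* : ∀ s t (x : ℤ) → 𝟙 (s ∧ t) * x ≡ 𝟙 s * (𝟙 t * x)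
𝟙-∧-* true  t x = sym (*-identityˡ (𝟙 t * x))
𝟙-∧-* false t x = refl

𝟙-∧-false : ∀ {s t} → (s ≡ true → t ≡ true → ⊥) → 𝟙 (s ∧ t) ≡ + 0
𝟙-∧-false {true}  {true}  ¬s∧t with () ← ¬s∧t refl refl
𝟙-∧-false {true}  {false} _ = refl
𝟙-∧-false {false}         _ = refl

x≡-x⇒x≡0 : ∀ (x : ℤ) → x ≡ - x → x ≡ + 0
x≡-x⇒x≡0 (+ ℕ.zero) _ = refl
x≡-x⇒x≡0 (+ ℕ.suc n) ()
x≡-x⇒x≡0 -[1+ n ] ()

eqᶠ⇒≡ : ∀ {n} (i j : Fin n) → eqᶠ i j ≡ true → i ≡ j
eqᶠ⇒≡ i j eq with i ≟ᶠ j
... | yes i≡j = i≡j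

eqᶠ-sym : ∀ {n} (i j : Fin n) → eqᶠ i j ≡ eqᶠ j i
eqᶠ-sym i j with i ≟ᶠ j
... | yes i≡j = sym (dec-true (j ≟ᶠ i) (sym i≡j))
... | no  i≢j = sym (dec-false (j ≟ᶠ i) (i≢j ∘ sym))

-- Sums over lists

sumOf : {X : Set} → (X → ℤ) → List X → ℤ
sumOf f xs = sumℤ (map f xs)

module _ {X : Set} where

  sumOf-cong : {f g : X → ℤ} → (∀ x → f x ≡ g x) → ∀ xs → sumOf f xs ≡ sumOf g xs
  sumOf-cong f≗g [] = refl
  sumOf-cong f≗g (x ∷ xs) = cong₂ _+_ (f≗g x) (sumOf-cong f≗g xs)

  sumOf-zero : ∀ xs → sumOf {X} (λ _ → + 0) xs ≡ + 0
  sumOf-zero [] = refl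
  sumOf-zero (x ∷ xs) = trans (+-identityˡ _) (sumOf-zero xs)

  sumOf-+ : (f g : X → ℤ) → ∀ xs → sumOf (λ x → f x + g x) xs ≡ sumOf f xs + sumOf g xs
  sumOf-+ f g [] = refl
  sumOf-+ f g (x ∷ xs) = begin
    (f x + g x) + sumOf (λ x → f x + g x) xs  ≡⟨ cong (_+_ (f x + g x)) (sumOf-+ f g xs) ⟩
    (f x + g x) + (sumOf f xs + sumOf g xs)   ≡⟨ interchange (f x) (g x) _ _ ⟩
    (f x + sumOf f xs) + (g x + sumOf g xs)   ∎

  sumOf-*ˡ : (k : ℤ) (f : X → ℤ) → ∀ xs → sumOf (λ x → k * f x) xs ≡ k * sumOf f xs
  sumOf-*ˡ k f [] = sym (*-zeroʳ k)
  sumOf-*ˡ k f (x ∷ xs) =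
    trans (cong (_+_ (k * f x)) (sumOf-*ˡ k f xs)) (sym (*-distribˡ-+ k (f x) (sumOf f xs)))

  sumOf-*ʳ : (k : ℤ) (f : X → ℤ) → ∀ xs → sumOf (λ x → f x * k) xs ≡ sumOf f xs * k
  sumOf-*ʳ k f xs = begin
    sumOf (λ x → f x * k) xs  ≡⟨ sumOf-cong (λ x → *-comm (f x) k) xs ⟩
    sumOf (λ x → k * f x) xs  ≡⟨ sumOf-*ˡ k f xs ⟩
    k * sumOf f xs            ≡⟨ *-comm k _ ⟩
    sumOf f xs * k            ∎

  sumOf-neg : (f : X → ℤ) → ∀ xs → sumOf (λ x → - f x) xs ≡ - sumOf f xs
  sumOf-neg f [] = refl
  sumOf-neg f (x ∷ xs) =
    trans (cong (_+_ (- f x)) (sumOf-neg f xs)) (sym (neg-distrib-+ (f x) (sumOf f xs)))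

  sumOf-- : (f g : X → ℤ) → ∀ xs → sumOf (λ x → f x - g x) xs ≡ sumOf f xs - sumOf g xs
  sumOf-- f g xs = trans (sumOf-+ f (λ x → - g x) xs) (cong (_+_ (sumOf f xs)) (sumOf-neg g xs))

  sumOf-++ : (f : X → ℤ) → ∀ xs ys → sumOf f (xs ++ ys) ≡ sumOf f xs + sumOf f ys
  sumOf-++ f [] ys = sym (+-identityˡ _)
  sumOf-++ f (x ∷ xs) ys =
    trans (cong (_+_ (f x)) (sumOf-++ f xs ys)) (sym (+-assoc (f x) (sumOf f xs) (sumOf f ys)))

  sumOf-filterᵇ : (P : X → Bool) (f : X → ℤ) → ∀ xs →
                  sumOf f (filterᵇ P xs) ≡ sumOf (λ x → 𝟙 (P x) * f x) xs
  sumOf-filterᵇ P f [] = refl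
  sumOf-filterᵇ P f (x ∷ xs) with P x
  ... | true  = cong₂ _+_ (sym (*-identityˡ (f x))) (sumOf-filterᵇ P f xs)
  ... | false = trans (sumOf-filterᵇ P f xs) (sym (+-identityˡ _))

  sumOf-filterᵇ-cong : (P : X → Bool) {f g : X → ℤ} → (∀ x → P x ≡ true → f x ≡ g x) → ∀ xs →
                       sumOf f (filterᵇ P xs) ≡ sumOf g (filterᵇ P xs)
  sumOf-filterᵇ-cong P f≗g [] = refl
  sumOf-filterᵇ-cong P f≗g (x ∷ xs) with P x in Px
  ... | true  = cong₂ _+_ (f≗g x Px) (sumOf-filterᵇ-cong P f≗g xs)
  ... | false = sumOf-filterᵇ-cong P f≗g xs

  length-filterᵇ : (P : X → Bool) → ∀ xs → + length (filterᵇ P xs) ≡ sumOf (𝟙 ∘ P) xs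
  length-filterᵇ P [] = refl
  length-filterᵇ P (x ∷ xs) with P x
  ... | true  = cong (_+_ (+ 1)) (length-filterᵇ P xs)
  ... | false = trans (length-filterᵇ P xs) (sym (+-identityˡ _))

  sumOf-*-shift : (w f : X → ℤ) (k : ℤ) → ∀ xs →
    sumOf (λ x → w x * (f x - k)) xs ≡ sumOf (λ x → w x * f x) xs - sumOf w xs * k
  sumOf-*-shift w f k xs = begin
    sumOf (λ x → w x * (f x - k)) xs
      ≡⟨ sumOf-cong (λ x → expand (w x) (f x) k) xs ⟩
    sumOf (λ x → w x * f x - w x * k) xs
      ≡⟨ sumOf-- _ _ xs ⟩
    sumOf (λ x → w x * f x) xs - sumOf (λ x → w x * k) xs
      ≡⟨ cong (_-_ (sumOf (λ x → w x * f x) xs)) (sumOf-*ʳ k w xs) ⟩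
    sumOf (λ x → w x * f x) xs - sumOf w xs * k ∎
    where
    expand : ∀ a b c → a * (b - c) ≡ a * b - a * c
    expand = solve-∀

  sumOf-*-affine : (f s : X → ℤ) (k m : ℤ) → ∀ xs → sumOf f xs ≡ + 0 →
    sumOf (λ x → f x * (k + m * s x)) xs ≡ m * sumOf (λ x → s x * f x) xs
  sumOf-*-affine f s k m xs Σf≡0 = begin
    sumOf (λ x → f x * (k + m * s x)) xs
      ≡⟨ sumOf-cong (λ x → expand (f x) k m (s x)) xs ⟩
    sumOf (λ x → k * f x + m * (s x * f x)) xs
      ≡⟨ sumOf-+ _ _ xs ⟩
    sumOf (λ x → k * f x) xs + sumOf (λ x → m * (s x * f x)) xs
      ≡⟨ cong₂ _+_ (sumOf-*ˡ k f xs) (sumOf-*ˡ m (λ x → s x * f x) xs) ⟩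
    k * sumOf f xs + m * sumOf (λ x → s x * f x) xs
      ≡⟨ cong (λ z → k * z + m * sumOf (λ x → s x * f x) xs) Σf≡0 ⟩
    k * + 0 + m * sumOf (λ x → s x * f x) xs
      ≡⟨ drop k _ ⟩
    m * sumOf (λ x → s x * f x) xs ∎
    where
    expand : ∀ a k m b → a * (k + m * b) ≡ k * a + m * (b * a)
    expand = solve-∀
    drop : ∀ k z → k * + 0 + z ≡ z
    drop = solve-∀

sumOf-map : {X Y : Set} (f : Y → ℤ) (g : X → Y) → ∀ xs → sumOf f (map g xs) ≡ sumOf (f ∘ g) xs
sumOf-map f g [] = refl
sumOf-map f g (x ∷ xs) = cong (_+_ (f (g x))) (sumOf-map f g xs)

module _ {X Y : Set} where

  sumOf-comm : (f : X → Y → ℤ) → ∀ xs ys →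
               sumOf (λ x → sumOf (f x) ys) xs ≡ sumOf (λ y → sumOf (λ x → f x y) xs) ys
  sumOf-comm f [] ys = sym (sumOf-zero ys)
  sumOf-comm f (x ∷ xs) ys =
    trans (cong (_+_ (sumOf (f x) ys)) (sumOf-comm f xs ys))
          (sym (sumOf-+ (f x) (λ y → sumOf (λ x' → f x' y) xs) ys))

  sumOf-cartesianProduct : (f : X × Y → ℤ) → ∀ xs ys →
    sumOf f (cartesianProduct xs ys) ≡ sumOf (λ x → sumOf (λ y → f (x , y)) ys) xs
  sumOf-cartesianProduct f [] ys = refl
  sumOf-cartesianProduct f (x ∷ xs) ys =
    trans (sumOf-++ f (map (x ,_) ys) _)
          (cong₂ _+_ (sumOf-map f (x ,_) ys) (sumOf-cartesianProduct f xs ys))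

sumOf-allFin-suc : ∀ {n} (f : Fin (ℕ.suc n) → ℤ) →
                   sumOf f (allFin (ℕ.suc n)) ≡ f zero + sumOf (f ∘ suc) (allFin n)
sumOf-allFin-suc {n} f =
  cong (_+_ (f zero)) (trans (cong sumℤ (map-tabulate suc f))
                             (sym (cong sumℤ (map-tabulate (λ i → i) (f ∘ suc)))))

sumOf-allFin-δ : ∀ {n} (j : Fin n) (f : Fin n → ℤ) → sumOf (λ i → 𝟙 (eqᶠ i j) * f i) (allFin n) ≡ f j
sumOf-allFin-δ {ℕ.suc n} zero f = begin
  sumOf (λ i → 𝟙 (eqᶠ i zero) * f i) (allFin (ℕ.suc n))
    ≡⟨ sumOf-allFin-suc (λ i → 𝟙 (eqᶠ i zero) * f i) ⟩
  + 1 * f zero + sumOf (λ _ → + 0) (allFin n)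
    ≡⟨ cong₂ _+_ (*-identityˡ (f zero)) (sumOf-zero (allFin n)) ⟩
  f zero + + 0
    ≡⟨ +-identityʳ (f zero) ⟩
  f zero ∎
sumOf-allFin-δ {ℕ.suc n} (suc j) f = begin
  sumOf (λ i → 𝟙 (eqᶠ i (suc j)) * f i) (allFin (ℕ.suc n)) ≡⟨ sumOf-allFin-suc (λ i → 𝟙 (eqᶠ i (suc j)) * f i) ⟩
  + 0 + sumOf (λ i → 𝟙 (eqᶠ i j) * f (suc i)) (allFin n)   ≡⟨ +-identityˡ _ ⟩
  sumOf (λ i → 𝟙 (eqᶠ i j) * f (suc i)) (allFin n)         ≡⟨ sumOf-allFin-δ j (f ∘ suc) ⟩
  f (suc j) ∎

-- Antisymmetric functions

module _ {X : Set} where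

  Antisymmetric : (X → X → ℤ) → Set
  Antisymmetric f = ∀ u v → f u v ≡ - f v u

  sumOf-orderedPairs : (H : X → X → ℤ) (w : X → ℤ) → Antisymmetric H → ∀ xs →
    sumOf (uncurry λ u v → H u v * (w u - w v)) (orderedPairs xs) ≡ sumOf (λ u → w u * sumOf (H u) xs) xs
  sumOf-orderedPairs H w anti [] = refl
  sumOf-orderedPairs H w anti (x ∷ xs) = begin
    sumOf F (map (x ,_) xs ++ orderedPairs xs)
      ≡⟨ sumOf-++ F (map (x ,_) xs) _ ⟩
    sumOf F (map (x ,_) xs) + sumOf F (orderedPairs xs)
      ≡⟨ cong₂ _+_ (sumOf-map F (x ,_) xs) (sumOf-orderedPairs H w anti xs) ⟩
    sumOf (λ v → H x v * (w x - w v)) xs + rest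
      ≡⟨ cong (_+ rest) outgoing ⟩
    (w x * sumOf (H x) xs - sumOf (λ v → H x v * w v) xs) + rest
      ≡⟨ rearrange (w x) _ _ rest ⟩
    w x * (+ 0 + sumOf (H x) xs) + (- sumOf (λ v → H x v * w v) xs + rest)
      ≡⟨ cong₂ (λ h i → w x * (h + sumOf (H x) xs) + (i + rest)) (sym (x≡-x⇒x≡0 _ (anti x x))) (sym incoming) ⟩
    w x * (H x x + sumOf (H x) xs) + (sumOf (λ u → w u * H u x) xs + rest)
      ≡⟨ cong (_+_ (w x * (H x x + sumOf (H x) xs))) (sym split) ⟩
    w x * sumOf (H x) (x ∷ xs) + sumOf (λ u → w u * sumOf (H u) (x ∷ xs)) xs ∎
    where
    F = uncurry λ u v → H u v * (w u - w v)
    rest = sumOf (λ u → w u * sumOf (H u) xs) xs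
    rearrange : ∀ a s t r → (a * s - t) + r ≡ a * (+ 0 + s) + (- t + r)
    rearrange = solve-∀
    outgoing : sumOf (λ v → H x v * (w x - w v)) xs ≡ w x * sumOf (H x) xs - sumOf (λ v → H x v * w v) xs
    outgoing = begin
      sumOf (λ v → H x v * (w x - w v)) xs           ≡⟨ sumOf-cong (λ v → expand (H x v) (w x) (w v)) xs ⟩
      sumOf (λ v → w x * H x v - H x v * w v) xs     ≡⟨ sumOf-- _ _ xs ⟩
      sumOf (λ v → w x * H x v) xs - sumOf (λ v → H x v * w v) xs
        ≡⟨ cong (_- sumOf (λ v → H x v * w v) xs) (sumOf-*ˡ (w x) (H x) xs) ⟩
      w x * sumOf (H x) xs - sumOf (λ v → H x v * w v) xs ∎
      where
      expand : ∀ h a b → h * (a - b) ≡ a * h - h * b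
      expand = solve-∀
    incoming : sumOf (λ u → w u * H u x) xs ≡ - sumOf (λ v → H x v * w v) xs
    incoming = trans (sumOf-cong (λ u → trans (cong (w u *_) (anti u x)) (pull-neg (w u) (H x u))) xs)
                     (sumOf-neg (λ v → H x v * w v) xs)
      where
      pull-neg : ∀ a h → a * - h ≡ - (h * a)
      pull-neg = solve-∀
    split : sumOf (λ u → w u * (H u x + sumOf (H u) xs)) xs ≡ sumOf (λ u → w u * H u x) xs + rest
    split = trans (sumOf-cong (λ u → *-distribˡ-+ (w u) (H u x) _) xs) (sumOf-+ _ _ xs)

  sumOf-sumOf-antisym : (f : X → X → ℤ) → Antisymmetric f → ∀ xs → sumOf (λ u → sumOf (f u) xs) xs ≡ + 0
  sumOf-sumOf-antisym f anti xs = x≡-x⇒x≡0 _ (begin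
    sumOf (λ u → sumOf (f u) xs) xs               ≡⟨ sumOf-comm f xs xs ⟩
    sumOf (λ v → sumOf (λ u → f u v) xs) xs       ≡⟨ sumOf-cong (λ v → sumOf-cong (λ u → anti u v) xs) xs ⟩
    sumOf (λ v → sumOf (λ u → - f v u) xs) xs     ≡⟨ sumOf-cong (λ v → sumOf-neg (f v) xs) xs ⟩
    sumOf (λ v → - sumOf (f v) xs) xs             ≡⟨ sumOf-neg _ xs ⟩
    - sumOf (λ u → sumOf (f u) xs) xs             ∎)

  sumOf-fibre-antisym : ∀ {n} (π : X → Fin n) (t : Fin n) (c : X → X → ℤ) → Antisymmetric c → ∀ xs →
    sumOf (λ u → 𝟙 (eqᶠ (π u) t) * sumOf (λ e → 𝟙 (eqᶠ (π u) (π e)) * c u e) xs) xs ≡ + 0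
  sumOf-fibre-antisym π t c anti xs = begin
    sumOf (λ u → 𝟙 (eqᶠ (π u) t) * sumOf (λ e → 𝟙 (eqᶠ (π u) (π e)) * c u e) xs) xs
      ≡⟨ sumOf-cong (λ u → restrict u (eqᶠ (π u) t) refl) xs ⟩
    sumOf (λ u → 𝟙 (eqᶠ (π u) t) * sumOf (λ e → 𝟙 (eqᶠ (π e) t) * c u e) xs) xs
      ≡⟨ sumOf-cong (λ u → sym (sumOf-*ˡ (𝟙 (eqᶠ (π u) t)) _ xs)) xs ⟩
    sumOf (λ u → sumOf (λ e → 𝟙 (eqᶠ (π u) t) * (𝟙 (eqᶠ (π e) t) * c u e)) xs) xs
      ≡⟨ sumOf-sumOf-antisym f f-anti xs ⟩
    + 0 ∎
    where
    χ : X → ℤ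
    χ x = 𝟙 (eqᶠ (π x) t)
    f : X → X → ℤ
    f u e = χ u * (χ e * c u e)
    swap : ∀ a b z → a * (b * - z) ≡ - (b * (a * z))
    swap = solve-∀
    f-anti : Antisymmetric f
    f-anti u e = trans (cong (λ z → χ u * (χ e * z)) (anti u e)) (swap (χ u) (χ e) (c e u))
    restrict : ∀ u (s : Bool) → eqᶠ (π u) t ≡ s →
      𝟙 s * sumOf (λ e → 𝟙 (eqᶠ (π u) (π e)) * c u e) xs ≡ 𝟙 s * sumOf (λ e → 𝟙 (eqᶠ (π e) t) * c u e) xs
    restrict u false _ = refl
    restrict u true πu≡t = cong (𝟙 true *_) (sumOf-cong {f = λ e → 𝟙 (eqᶠ (π u) (π e)) * c u e} (λ e →
      cong (λ b → 𝟙 b * c u e) (trans (cong (λ i → eqᶠ i (π e)) (eqᶠ⇒≡ (π u) t πu≡t)) (eqᶠ-sym t (π e)))) xs)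

-- The graphs G and line G

edgeChain-reverse : ∀ {p q} (u v x y : Fin p ⊎ Fin q) → edgeChain v u x y ≡ - edgeChain u v x y
edgeChain-reverse u v x y = swap (𝟙 (eqV u x ∧ eqV v y)) (𝟙 (eqV v x ∧ eqV u y))
  where
  swap : ∀ (s t : ℤ) → t - s ≡ - (s - t)
  swap = solve-∀

edgeChain-antisym : ∀ {p q} (u v x y : Fin p ⊎ Fin q) → edgeChain u v x y ≡ - edgeChain u v y x
edgeChain-antisym u v x y =
  trans (cong₂ (λ s t → 𝟙 s - 𝟙 t) (∧-comm (eqV u x) (eqV v y)) (∧-comm (eqV v x) (eqV u y)))
        (edgeChain-reverse u v y x)

module _ {p q : ℕ} (A : BiAdj p q) where

  Edge : Set
  Edge = Fin p × Fin q

  edges : List Edge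
  edges = verts (lineGraph A)

  edge≢nonEdge : ∀ {a b a' b'} → A a b ≡ true → A a' b' ≡ false → eqᶠ a a' ≡ true → eqᶠ b b' ≡ true → ⊥
  edge≢nonEdge {a} {b} {a'} {b'} Aab ¬Aa'b' a≟a' b≟b'
    with () ← trans (sym Aab) (trans (cong₂ A (eqᶠ⇒≡ a a' a≟a') (eqᶠ⇒≡ b b' b≟b')) ¬Aa'b')

  edgeChain-off : ∀ a b x y → A a b ≡ true → bipAdj A x y ≡ false → edgeChain (inj₁ a) (inj₂ b) x y ≡ + 0
  edgeChain-off a b (inj₁ a') (inj₁ a'') _ _ = cong (λ s → 𝟙 s - + 0) (∧-zeroʳ (eqᶠ a a'))
  edgeChain-off a b (inj₂ b') (inj₂ b'') _ _ = cong (λ s → + 0 - 𝟙 s) (∧-zeroʳ (eqᶠ b b'))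
  edgeChain-off a b (inj₁ a') (inj₂ b') Aab ¬Aa'b' = cong (_- + 0) (𝟙-∧-false (edge≢nonEdge Aab ¬Aa'b'))
  edgeChain-off a b (inj₂ b') (inj₁ a') Aab ¬Aa'b' =
    cong (_-_ (+ 0)) (𝟙-∧-false (flip (edge≢nonEdge Aab ¬Aa'b')))

  lineAdj⇒adj : ∀ a b a' b' → lineAdj A (a , b) (a' , b') ≡ true → A a b ≡ true × A a' b' ≡ true
  lineAdj⇒adj a b a' b' adj with A a b | A a' b'
  ... | true | true = refl , refl

  sumOf-edges : (f : Edge → ℤ) →
    sumOf f edges ≡ sumOf (λ a → sumOf (λ b → 𝟙 (A a b) * f (a , b)) (allFin q)) (allFin p)
  sumOf-edges f = trans (sumOf-filterᵇ _ f (cartesianProduct (allFin p) (allFin q)))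
                        (sumOf-cartesianProduct _ (allFin p) (allFin q))

  sumOf-edges-at₁ : ∀ a (f : Edge → ℤ) →
    sumOf (λ u → 𝟙 (eqᶠ (proj₁ u) a) * f u) edges ≡ sumOf (λ b → 𝟙 (A a b) * f (a , b)) (allFin q)
  sumOf-edges-at₁ a f = begin
    sumOf (λ u → 𝟙 (eqᶠ (proj₁ u) a) * f u) edges
      ≡⟨ sumOf-edges _ ⟩
    sumOf (λ a' → sumOf (λ b → 𝟙 (A a' b) * (𝟙 (eqᶠ a' a) * f (a' , b))) (allFin q)) (allFin p)
      ≡⟨ sumOf-cong pull-δ (allFin p) ⟩
    sumOf (λ a' → 𝟙 (eqᶠ a' a) * sumOf (λ b → 𝟙 (A a' b) * f (a' , b)) (allFin q)) (allFin p)
      ≡⟨ sumOf-allFin-δ a (λ a' → sumOf (λ b → 𝟙 (A a' b) * f (a' , b)) (allFin q)) ⟩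
    sumOf (λ b → 𝟙 (A a b) * f (a , b)) (allFin q) ∎
    where
    pull-δ : ∀ a' → sumOf (λ b → 𝟙 (A a' b) * (𝟙 (eqᶠ a' a) * f (a' , b))) (allFin q)
                    ≡ 𝟙 (eqᶠ a' a) * sumOf (λ b → 𝟙 (A a' b) * f (a' , b)) (allFin q)
    pull-δ a' = trans (sumOf-cong (λ b → x∙yz≈y∙xz (𝟙 (A a' b)) (𝟙 (eqᶠ a' a)) (f (a' , b))) (allFin q))
                      (sumOf-*ˡ (𝟙 (eqᶠ a' a)) (λ b → 𝟙 (A a' b) * f (a' , b)) (allFin q))

  sumOf-edges-at₂ : ∀ b (f : Edge → ℤ) →
    sumOf (λ u → 𝟙 (eqᶠ (proj₂ u) b) * f u) edges ≡ sumOf (λ a → 𝟙 (A a b) * f (a , b)) (allFin p)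
  sumOf-edges-at₂ b f = begin
    sumOf (λ u → 𝟙 (eqᶠ (proj₂ u) b) * f u) edges
      ≡⟨ sumOf-edges _ ⟩
    sumOf (λ a → sumOf (λ b' → 𝟙 (A a b') * (𝟙 (eqᶠ b' b) * f (a , b'))) (allFin q)) (allFin p)
      ≡⟨ sumOf-cong select-b (allFin p) ⟩
    sumOf (λ a → 𝟙 (A a b) * f (a , b)) (allFin p) ∎
    where
    select-b : ∀ a → sumOf (λ b' → 𝟙 (A a b') * (𝟙 (eqᶠ b' b) * f (a , b'))) (allFin q) ≡ 𝟙 (A a b) * f (a , b)
    select-b a = trans (sumOf-cong (λ b' → x∙yz≈y∙xz (𝟙 (A a b')) (𝟙 (eqᶠ b' b)) (f (a , b'))) (allFin q))
                       (sumOf-allFin-δ b (λ b' → 𝟙 (A a b') * f (a , b')))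

  sumOf-edges-point : ∀ a b (f : Edge → ℤ) →
    sumOf (λ u → 𝟙 (eqᶠ (proj₁ u) a ∧ eqᶠ (proj₂ u) b) * f u) edges ≡ 𝟙 (A a b) * f (a , b)
  sumOf-edges-point a b f = begin
    sumOf (λ u → 𝟙 (eqᶠ (proj₁ u) a ∧ eqᶠ (proj₂ u) b) * f u) edges
      ≡⟨ sumOf-cong (λ u → 𝟙-∧-* (eqᶠ (proj₁ u) a) (eqᶠ (proj₂ u) b) (f u)) edges ⟩
    sumOf (λ u → 𝟙 (eqᶠ (proj₁ u) a) * (𝟙 (eqᶠ (proj₂ u) b) * f u)) edges
      ≡⟨ sumOf-edges-at₁ a _ ⟩
    sumOf (λ b' → 𝟙 (A a b') * (𝟙 (eqᶠ b' b) * f (a , b'))) (allFin q)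
      ≡⟨ sumOf-cong (λ b' → x∙yz≈y∙xz (𝟙 (A a b')) (𝟙 (eqᶠ b' b)) (f (a , b'))) (allFin q) ⟩
    sumOf (λ b' → 𝟙 (eqᶠ b' b) * (𝟙 (A a b') * f (a , b'))) (allFin q)
      ≡⟨ sumOf-allFin-δ b (λ b' → 𝟙 (A a b') * f (a , b')) ⟩
    𝟙 (A a b) * f (a , b) ∎

  deg₂-as-sum : ∀ b → + deg₂ A b ≡ sumOf (λ u → 𝟙 (eqᶠ (proj₂ u) b)) edges
  deg₂-as-sum b = begin
    + deg₂ A b
      ≡⟨ length-filterᵇ (λ a → A a b) (allFin p) ⟩
    sumOf (λ a → 𝟙 (A a b)) (allFin p)
      ≡⟨ sumOf-cong (λ a → sym (*-identityʳ (𝟙 (A a b)))) (allFin p) ⟩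
    sumOf (λ a → 𝟙 (A a b) * + 1) (allFin p)
      ≡⟨ sumOf-edges-at₂ b (λ _ → + 1) ⟨
    sumOf (λ u → 𝟙 (eqᶠ (proj₂ u) b) * + 1) edges
      ≡⟨ sumOf-cong (λ u → *-identityʳ (𝟙 (eqᶠ (proj₂ u) b))) edges ⟩
    sumOf (λ u → 𝟙 (eqᶠ (proj₂ u) b)) edges ∎

  deg₁-as-sum : ∀ a → + deg₁ A a ≡ sumOf (λ u → 𝟙 (eqᶠ (proj₁ u) a)) edges
  deg₁-as-sum a = begin
    + deg₁ A a
      ≡⟨ length-filterᵇ (A a) (allFin q) ⟩
    sumOf (λ b → 𝟙 (A a b)) (allFin q)
      ≡⟨ sumOf-cong (λ b → sym (*-identityʳ (𝟙 (A a b)))) (allFin q) ⟩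
    sumOf (λ b → 𝟙 (A a b) * + 1) (allFin q)
      ≡⟨ sumOf-edges-at₁ a (λ _ → + 1) ⟨
    sumOf (λ u → 𝟙 (eqᶠ (proj₁ u) a) * + 1) edges
      ≡⟨ sumOf-cong (λ u → *-identityʳ (𝟙 (eqᶠ (proj₁ u) a))) edges ⟩
    sumOf (λ u → 𝟙 (eqᶠ (proj₁ u) a)) edges ∎

  sumOf-vertices : (h : Fin p ⊎ Fin q → ℤ) →
    sumOf h (verts (bipGraph A)) ≡ sumOf (h ∘ inj₁) (allFin p) + sumOf (h ∘ inj₂) (allFin q)
  sumOf-vertices h = trans (sumOf-++ h (map inj₁ (allFin p)) (map inj₂ (allFin q)))
                           (cong₂ _+_ (sumOf-map h inj₁ (allFin p)) (sumOf-map h inj₂ (allFin q)))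

  lineAdj⇒shareOne : ∀ a b a' b' → lineAdj A (a , b) (a' , b') ≡ true → eqᶠ b b' ≡ not (eqᶠ a a')
  lineAdj⇒shareOne a b a' b' adj with A a b | A a' b' | eqᶠ a a' | eqᶠ b b'
  ... | true | true | true  | false = refl
  ... | true | true | false | true  = refl

  ¬lineAdj⇒shareBothOrNone : ∀ a b a' b' → A a b ≡ true → A a' b' ≡ true →
    lineAdj A (a , b) (a' , b') ≡ false → eqᶠ b b' ≡ eqᶠ a a'
  ¬lineAdj⇒shareBothOrNone a b a' b' Aab Aa'b' ¬adj with A a b | A a' b' | eqᶠ a a' | eqᶠ b b'
  ... | true | true | true  | true  = refl
  ... | true | true | false | false = refl

  lineAdj-sym : ∀ e e' → lineAdj A e e' ≡ lineAdj A e' e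
  lineAdj-sym (a , b) (a' , b') rewrite eqᶠ-sym a a' | eqᶠ-sym b b' with A a b | A a' b'
  ... | true  | true  = refl
  ... | true  | false = refl
  ... | false | true  = refl
  ... | false | false = refl

  basis : Edge → Chain (bipGraph A)
  basis (a , b) = edgeChain (inj₁ a) (inj₂ b)

-- The map g

module _ {p q : ℕ} (A : BiAdj p q) (d₁ d₂ : ℕ) .{{_ : NonZero d₁}} .{{_ : NonZero d₂}} where

  ℓ₁ ℓ₂ : ℤ
  ℓ₁ = + (lcm d₁ d₂ / d₁)
  ℓ₂ = + (lcm d₁ d₂ / d₂)

  ℓ₁d₁≡ℓ₂d₂ : ℓ₁ * + d₁ ≡ ℓ₂ * + d₂
  ℓ₁d₁≡ℓ₂d₂ = begin
    ℓ₁ * + d₁                        ≡⟨ pos-* (lcm d₁ d₂ / d₁) d₁ ⟨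
    + (lcm d₁ d₂ / d₁ ℕ.* d₁)        ≡⟨ cong +_ (m/n*n≡m (m∣lcm[m,n] d₁ d₂)) ⟩
    + lcm d₁ d₂                      ≡⟨ cong +_ (m/n*n≡m (n∣lcm[m,n] d₁ d₂)) ⟨
    + (lcm d₁ d₂ / d₂ ℕ.* d₂)        ≡⟨ pos-* (lcm d₁ d₂ / d₂) d₂ ⟩
    ℓ₂ * + d₂                        ∎

  shareCoeff : Bool → ℤ
  shareCoeff true  = ℓ₂
  shareCoeff false = - ℓ₁

  shareCoeff-not-* : ∀ s δ → δ * shareCoeff (not s) ≡ (𝟙 (not s) * ℓ₂ - 𝟙 s * ℓ₁) * δ
  shareCoeff-not-* true  δ = ring δ ℓ₁ ℓ₂
    where
    ring : ∀ δ l₁ l₂ → δ * - l₁ ≡ (+ 0 * l₂ - + 1 * l₁) * δ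
    ring = solve-∀
  shareCoeff-not-* false δ = ring δ ℓ₁ ℓ₂
    where
    ring : ∀ δ l₁ l₂ → δ * l₂ ≡ (+ 1 * l₂ - + 0 * l₁) * δ
    ring = solve-∀

  shareCoeff-affine : ∀ s → shareCoeff s ≡ - ℓ₁ + (ℓ₁ + ℓ₂) * 𝟙 s
  shareCoeff-affine true  = ring ℓ₁ ℓ₂
    where
    ring : ∀ l₁ l₂ → l₂ ≡ - l₁ + (l₁ + l₂) * + 1
    ring = solve-∀
  shareCoeff-affine false = ring ℓ₁ ℓ₂
    where
    ring : ∀ l₁ l₂ → - l₁ ≡ - l₁ + (l₁ + l₂) * + 0
    ring = solve-∀

  shareCoeff-not-affine : ∀ s → shareCoeff (not s) ≡ ℓ₂ + - (ℓ₁ + ℓ₂) * 𝟙 s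
  shareCoeff-not-affine true  = ring ℓ₁ ℓ₂
    where
    ring : ∀ l₁ l₂ → - l₁ ≡ l₂ + - (l₁ + l₂) * + 1
    ring = solve-∀
  shareCoeff-not-affine false = ring ℓ₁ ℓ₂
    where
    ring : ∀ l₁ l₂ → l₂ ≡ l₂ + - (l₁ + l₂) * + 0
    ring = solve-∀

  gCoeff : Edge A → Edge A → ℤ
  gCoeff (a , b) (a' , b') = if lineAdj A (a , b) (a' , b') then shareCoeff (eqᶠ b b') else + 0

  gCoeff-adj : ∀ a b a' b' → lineAdj A (a , b) (a' , b') ≡ true → gCoeff (a , b) (a' , b') ≡ shareCoeff (eqᶠ b b')
  gCoeff-adj a b a' b' adj = cong (λ t → if t then shareCoeff (eqᶠ b b') else + 0) adj

  gCoeff-sym : ∀ e e' → gCoeff e e' ≡ gCoeff e' e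
  gCoeff-sym (a , b) (a' , b') =
    cong₂ (λ t s → if t then shareCoeff s else + 0) (lineAdj-sym A (a , b) (a' , b')) (eqᶠ-sym b b')

  gEdge≡gCoeff*basis : ∀ e e' x y → gEdge A d₁ d₂ e e' x y ≡ gCoeff e e' * (basis A e x y - basis A e' x y)
  gEdge≡gCoeff*basis (a , b) (a' , b') x y with lineAdj A (a , b) (a' , b') in adj
  ... | false = refl
  ... | true with eqᶠ b b' in b≟b' | lineAdj⇒shareOne A a b a' b' adj
  ...   | true  | _ = begin
    ℓ₂ * (basis A (a , b) x y + edgeChain (inj₂ b) (inj₁ a') x y)
      ≡⟨ cong (λ z → ℓ₂ * (basis A (a , b) x y + z)) (edgeChain-reverse (inj₁ a') (inj₂ b) x y) ⟩
    ℓ₂ * (basis A (a , b) x y - basis A (a' , b) x y)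
      ≡⟨ cong (λ b'' → ℓ₂ * (basis A (a , b) x y - basis A (a' , b'') x y)) (eqᶠ⇒≡ b b' b≟b') ⟩
    ℓ₂ * (basis A (a , b) x y - basis A (a' , b') x y) ∎
  ...   | false | shareOne = begin
    ℓ₁ * (edgeChain (inj₂ b) (inj₁ a) x y + basis A (a , b') x y)
      ≡⟨ cong (λ z → ℓ₁ * (z + basis A (a , b') x y)) (edgeChain-reverse (inj₁ a) (inj₂ b) x y) ⟩
    ℓ₁ * (- basis A (a , b) x y + basis A (a , b') x y)
      ≡⟨ pull-sign ℓ₁ (basis A (a , b) x y) (basis A (a , b') x y) ⟩
    - ℓ₁ * (basis A (a , b) x y - basis A (a , b') x y)
      ≡⟨ cong (λ a'' → - ℓ₁ * (basis A (a , b) x y - basis A (a'' , b') x y)) (eqᶠ⇒≡ a a' a≟a') ⟩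
    - ℓ₁ * (basis A (a , b) x y - basis A (a' , b') x y) ∎
    where
    pull-sign : ∀ k u v → k * (- u + v) ≡ - k * (u - v)
    pull-sign = solve-∀
    a≟a' : eqᶠ a a' ≡ true
    a≟a' = not-injective (sym shareOne)

  gEdge-antisym : ∀ e e' x y → gEdge A d₁ d₂ e e' x y ≡ - gEdge A d₁ d₂ e e' y x
  gEdge-antisym e e' x y = begin
    gEdge A d₁ d₂ e e' x y
      ≡⟨ gEdge≡gCoeff*basis e e' x y ⟩
    gCoeff e e' * (basis A e x y - basis A e' x y)
      ≡⟨ cong₂ (λ u v → gCoeff e e' * (u - v)) (basis-antisym e) (basis-antisym e') ⟩
    gCoeff e e' * (- basis A e y x - - basis A e' y x)
      ≡⟨ pull-sign (gCoeff e e') (basis A e y x) (basis A e' y x) ⟩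
    - (gCoeff e e' * (basis A e y x - basis A e' y x))
      ≡⟨ cong -_ (gEdge≡gCoeff*basis e e' y x) ⟨
    - gEdge A d₁ d₂ e e' y x ∎
    where
    basis-antisym : ∀ e → basis A e x y ≡ - basis A e y x
    basis-antisym (a , b) = edgeChain-antisym (inj₁ a) (inj₂ b) x y
    pull-sign : ∀ k u v → k * (- u - - v) ≡ - (k * (u - v))
    pull-sign = solve-∀

  gEdge-off : ∀ e e' x y → bipAdj A x y ≡ false → gEdge A d₁ d₂ e e' x y ≡ + 0
  gEdge-off (a , b) (a' , b') x y ¬xy =
    trans (gEdge≡gCoeff*basis (a , b) (a' , b') x y) (vanish (lineAdj A (a , b) (a' , b')) refl)
    where
    vanish : ∀ t → lineAdj A (a , b) (a' , b') ≡ t →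
      (if t then shareCoeff (eqᶠ b b') else + 0) * (basis A (a , b) x y - basis A (a' , b') x y) ≡ + 0
    vanish false _ = refl
    vanish true adj with (Aab , Aa'b') ← lineAdj⇒adj A a b a' b' adj =
      trans (cong₂ (λ u v → shareCoeff (eqᶠ b b') * (u - v))
                   (edgeChain-off A a b x y Aab ¬xy) (edgeChain-off A a' b' x y Aa'b' ¬xy))
            (*-zeroʳ (shareCoeff (eqᶠ b b')))

  gMap-+ : (c c' : Chain (lineGraph A)) → ∀ x y →
    gMap A d₁ d₂ (λ e e' → c e e' + c' e e') x y ≡ gMap A d₁ d₂ c x y + gMap A d₁ d₂ c' x y
  gMap-+ c c' x y =
    trans (sumOf-cong (uncurry λ e e' → *-distribʳ-+ (gEdge A d₁ d₂ e e' x y) (c e e') (c' e e'))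
                      (orderedPairs (edges A)))
          (sumOf-+ _ _ (orderedPairs (edges A)))

  gMap-cong : (c c' : Chain (lineGraph A)) → (∀ e e' → c e e' ≡ c' e e') → ∀ x y →
    gMap A d₁ d₂ c x y ≡ gMap A d₁ d₂ c' x y
  gMap-cong c c' c≗c' x y =
    sumOf-cong (uncurry λ e e' → cong (_* gEdge A d₁ d₂ e e' x y) (c≗c' e e')) (orderedPairs (edges A))

  gMap-isChain : (c : Chain (lineGraph A)) → IsChain (bipGraph A) (gMap A d₁ d₂ c)
  gMap-isChain c = antisym , off
    where
    antisym : ∀ x y → gMap A d₁ d₂ c x y ≡ - gMap A d₁ d₂ c y x
    antisym x y = trans
      (sumOf-cong (uncurry λ e e' → trans (cong (c e e' *_) (gEdge-antisym e e' x y))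
                                         (sym (neg-distribʳ-* (c e e') (gEdge A d₁ d₂ e e' y x))))
                  (orderedPairs (edges A)))
      (sumOf-neg _ (orderedPairs (edges A)))
    off : ∀ x y → bipAdj A x y ≡ false → gMap A d₁ d₂ c x y ≡ + 0
    off x y ¬xy = trans
      (sumOf-cong (uncurry λ e e' → trans (cong (c e e' *_) (gEdge-off e e' x y ¬xy)) (*-zeroʳ (c e e')))
                  (orderedPairs (edges A)))
      (sumOf-zero (orderedPairs (edges A)))

  gAt : Chain (lineGraph A) → Edge A → ℤ
  gAt c u = sumOf (λ e → c u e * gCoeff u e) (edges A)

  gMap-on-edge : (c : Chain (lineGraph A)) → Antisymmetric c → ∀ a b →
    gMap A d₁ d₂ c (inj₁ a) (inj₂ b) ≡ 𝟙 (A a b) * gAt c (a , b)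
  gMap-on-edge c anti a b = begin
    gMap A d₁ d₂ c x y
      ≡⟨ sumOf-cong (uncurry λ e e' → trans (cong (c e e' *_) (gEdge≡gCoeff*basis e e' x y))
                                            (sym (*-assoc (c e e') (gCoeff e e') _)))
                    (orderedPairs (edges A)) ⟩
    sumOf (uncurry λ e e' → H e e' * (basis A e x y - basis A e' x y)) (orderedPairs (edges A))
      ≡⟨ sumOf-orderedPairs H (λ e → basis A e x y) H-anti (edges A) ⟩
    sumOf (λ u → basis A u x y * gAt c u) (edges A)
      ≡⟨ sumOf-cong (λ u → cong (_* gAt c u) (+-identityʳ (𝟙 (eqᶠ (proj₁ u) a ∧ eqᶠ (proj₂ u) b)))) (edges A) ⟩
    sumOf (λ u → 𝟙 (eqᶠ (proj₁ u) a ∧ eqᶠ (proj₂ u) b) * gAt c u) (edges A)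
      ≡⟨ sumOf-edges-point A a b (gAt c) ⟩
    𝟙 (A a b) * gAt c (a , b) ∎
    where
    x y : Fin p ⊎ Fin q
    x = inj₁ a
    y = inj₂ b
    H : Edge A → Edge A → ℤ
    H e e' = c e e' * gCoeff e e'
    H-anti : Antisymmetric H
    H-anti e e' = trans (cong₂ _*_ (anti e e') (gCoeff-sym e e')) (sym (neg-distribˡ-* (c e' e) (gCoeff e' e)))

  module _ (c : Chain (lineGraph A)) (c-cycle : InCycle (lineGraph A) c) where

    private
      anti : Antisymmetric c
      anti = proj₁ (proj₁ c-cycle)
      off : ∀ u v → lineAdj A u v ≡ false → c u v ≡ + 0
      off = proj₂ (proj₁ c-cycle)

      vanishing : ∀ {u e} {k k'} → c u e ≡ + 0 → c u e * k ≡ c u e * k'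
      vanishing {k = k} {k'} c≡0 = trans (cong (_* k) c≡0) (sym (cong (_* k') c≡0))

    σ : ∀ {n} → (Edge A → Fin n) → Edge A → ℤ
    σ π u = sumOf (λ e → 𝟙 (eqᶠ (π u) (π e)) * c u e) (edges A)

    cycle-outflow : ∀ u → sumOf (c u) (edges A) ≡ + 0
    cycle-outflow u = begin
      sumOf (c u) (edges A)                ≡⟨ sumOf-cong (anti u) (edges A) ⟩
      sumOf (λ e → - c e u) (edges A)      ≡⟨ sumOf-neg (λ e → c e u) (edges A) ⟩
      - sumOf (λ e → c e u) (edges A)      ≡⟨ cong -_ (proj₂ c-cycle u) ⟩
      + 0                                  ∎

    -- Zero outflow kills the constant part k of gCoeff, so only the flow σ inside one star of G survives.
    gAt-cycle : ∀ {n} (π : Edge A → Fin n) (k m : ℤ) →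
      (∀ u e → lineAdj A u e ≡ true → gCoeff u e ≡ k + m * 𝟙 (eqᶠ (π u) (π e))) →
      ∀ u → gAt c u ≡ m * σ π u
    gAt-cycle π k m coeff u =
      trans (sumOf-cong term (edges A))
            (sumOf-*-affine (c u) (λ e → 𝟙 (eqᶠ (π u) (π e))) k m (edges A) (cycle-outflow u))
      where
      term : ∀ e → c u e * gCoeff u e ≡ c u e * (k + m * 𝟙 (eqᶠ (π u) (π e)))
      term e = by-adjacency (lineAdj A u e) refl
        where
        by-adjacency : ∀ t → lineAdj A u e ≡ t → c u e * gCoeff u e ≡ c u e * (k + m * 𝟙 (eqᶠ (π u) (π e)))
        by-adjacency true  adj = cong (c u e *_) (coeff u e adj)
        by-adjacency false adj = vanishing (off u e adj)

    gAt-cycle₂ : ∀ u → gAt c u ≡ (ℓ₁ + ℓ₂) * σ proj₂ u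
    gAt-cycle₂ = gAt-cycle proj₂ (- ℓ₁) (ℓ₁ + ℓ₂) λ { (a , b) (a' , b') adj →
      trans (gCoeff-adj a b a' b' adj) (shareCoeff-affine (eqᶠ b b')) }

    gAt-cycle₁ : ∀ u → gAt c u ≡ - (ℓ₁ + ℓ₂) * σ proj₁ u
    gAt-cycle₁ = gAt-cycle proj₁ ℓ₂ (- (ℓ₁ + ℓ₂)) λ { (a , b) (a' , b') adj →
      trans (gCoeff-adj a b a' b' adj)
            (trans (cong shareCoeff (lineAdj⇒shareOne A a b a' b' adj)) (shareCoeff-not-affine (eqᶠ a a'))) }

    private
      fibre-gAt : ∀ {n} (π : Edge A → Fin n) (m : ℤ) → (∀ u → gAt c u ≡ m * σ π u) → ∀ t →
        sumOf (λ u → 𝟙 (eqᶠ (π u) t) * gAt c u) (edges A) ≡ + 0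
      fibre-gAt π m gAt≡mσ t = begin
        sumOf (λ u → 𝟙 (eqᶠ (π u) t) * gAt c u) (edges A)
          ≡⟨ sumOf-cong pull-m (edges A) ⟩
        sumOf (λ u → m * (𝟙 (eqᶠ (π u) t) * σ π u)) (edges A)
          ≡⟨ sumOf-*ˡ m _ (edges A) ⟩
        m * sumOf (λ u → 𝟙 (eqᶠ (π u) t) * σ π u) (edges A)
          ≡⟨ cong (m *_) (sumOf-fibre-antisym π t c anti (edges A)) ⟩
        m * + 0
          ≡⟨ *-zeroʳ m ⟩
        + 0 ∎
        where
        pull-m : ∀ u → 𝟙 (eqᶠ (π u) t) * gAt c u ≡ m * (𝟙 (eqᶠ (π u) t) * σ π u)
        pull-m u = trans (cong (𝟙 (eqᶠ (π u) t) *_) (gAt≡mσ u)) (x∙yz≈y∙xz (𝟙 (eqᶠ (π u) t)) m (σ π u))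

    gMap-cycle : InCycle (bipGraph A) (gMap A d₁ d₂ c)
    gMap-cycle = gMap-isChain c , λ { (inj₁ a) → at₁ a ; (inj₂ b) → at₂ b }
      where
      g = gMap A d₁ d₂ c
      g-antisym = proj₁ (gMap-isChain c)
      g-off = proj₂ (gMap-isChain c)
      at₂ : ∀ b → sumOf (λ x → g x (inj₂ b)) (verts (bipGraph A)) ≡ + 0
      at₂ b = begin
        sumOf (λ x → g x (inj₂ b)) (verts (bipGraph A))
          ≡⟨ sumOf-vertices A (λ x → g x (inj₂ b)) ⟩
        sumOf (λ a → g (inj₁ a) (inj₂ b)) (allFin p) + sumOf (λ b' → g (inj₂ b') (inj₂ b)) (allFin q)
          ≡⟨ cong₂ _+_ (sumOf-cong (λ a → gMap-on-edge c anti a b) (allFin p))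
                       (sumOf-cong (λ b' → g-off (inj₂ b') (inj₂ b) refl) (allFin q)) ⟩
        sumOf (λ a → 𝟙 (A a b) * gAt c (a , b)) (allFin p) + sumOf (λ _ → + 0) (allFin q)
          ≡⟨ cong₂ _+_ (sym (sumOf-edges-at₂ A b (gAt c))) (sumOf-zero (allFin q)) ⟩
        sumOf (λ u → 𝟙 (eqᶠ (proj₂ u) b) * gAt c u) (edges A) + + 0
          ≡⟨ cong (_+ + 0) (fibre-gAt proj₂ (ℓ₁ + ℓ₂) gAt-cycle₂ b) ⟩
        + 0 ∎
      at₁ : ∀ a → sumOf (λ x → g x (inj₁ a)) (verts (bipGraph A)) ≡ + 0
      at₁ a = begin
        sumOf (λ x → g x (inj₁ a)) (verts (bipGraph A))
          ≡⟨ sumOf-vertices A (λ x → g x (inj₁ a)) ⟩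
        sumOf (λ a' → g (inj₁ a') (inj₁ a)) (allFin p) + sumOf (λ b → g (inj₂ b) (inj₁ a)) (allFin q)
          ≡⟨ cong₂ _+_ (sumOf-cong (λ a' → g-off (inj₁ a') (inj₁ a) refl) (allFin p))
                       (sumOf-cong (λ b → trans (g-antisym (inj₂ b) (inj₁ a))
                                                (cong -_ (gMap-on-edge c anti a b))) (allFin q)) ⟩
        sumOf (λ _ → + 0) (allFin p) + sumOf (λ b → - (𝟙 (A a b) * gAt c (a , b))) (allFin q)
          ≡⟨ cong₂ _+_ (sumOf-zero (allFin p)) (sumOf-neg _ (allFin q)) ⟩
        + 0 + - sumOf (λ b → 𝟙 (A a b) * gAt c (a , b)) (allFin q)
          ≡⟨ cong (λ z → + 0 + - z) (sumOf-edges-at₁ A a (gAt c)) ⟨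
        + 0 + - sumOf (λ u → 𝟙 (eqᶠ (proj₁ u) a) * gAt c u) (edges A)
          ≡⟨ cong (λ z → + 0 + - z) (fibre-gAt proj₁ (- (ℓ₁ + ℓ₂)) gAt-cycle₁ a) ⟩
        + 0 ∎

  module _ (regular : Semiregular A d₁ d₂) (c : Chain (lineGraph A)) (c-bond : InBond (lineGraph A) c) where

    private
      φ : Edge A → ℤ
      φ = proj₁ (proj₂ c-bond)
      c≡δφ : ∀ u e → lineAdj A u e ≡ true → c u e ≡ φ e - φ u
      c≡δφ = proj₂ (proj₂ c-bond)

    Φ : ∀ {n} → (Edge A → Fin n) → Fin n → ℤ
    Φ π t = sumOf (λ u → 𝟙 (eqᶠ (π u) t) * φ u) (edges A)

    ψ : Fin p ⊎ Fin q → ℤ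
    ψ (inj₁ a) = ℓ₁ * Φ proj₁ a
    ψ (inj₂ b) = ℓ₂ * Φ proj₂ b

    bond-term : ∀ a b a' b' → A a b ≡ true → A a' b' ≡ true →
      c (a , b) (a' , b') * gCoeff (a , b) (a' , b')
        ≡ (𝟙 (eqᶠ b' b) * ℓ₂ - 𝟙 (eqᶠ a' a) * ℓ₁) * (φ (a' , b') - φ (a , b))
    bond-term a b a' b' Aab Aa'b' = by-adjacency (lineAdj A u e) refl
      where
      u e : Edge A
      u = (a , b)
      e = (a' , b')
      δ = φ e - φ u
      by-adjacency : ∀ t → lineAdj A u e ≡ t → c u e * gCoeff u e ≡ (𝟙 (eqᶠ b' b) * ℓ₂ - 𝟙 (eqᶠ a' a) * ℓ₁) * δ
      by-adjacency true adj = begin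
        c u e * gCoeff u e                           ≡⟨ cong₂ _*_ (c≡δφ u e adj) (gCoeff-adj a b a' b' adj) ⟩
        δ * shareCoeff (eqᶠ b b')                    ≡⟨ cong (λ s → δ * shareCoeff s) shareOne ⟩
        δ * shareCoeff (not (eqᶠ a a'))              ≡⟨ shareCoeff-not-* (eqᶠ a a') δ ⟩
        (𝟙 (not (eqᶠ a a')) * ℓ₂ - 𝟙 (eqᶠ a a') * ℓ₁) * δ
          ≡⟨ cong₂ (λ s s' → (𝟙 s * ℓ₂ - 𝟙 s' * ℓ₁) * δ) (trans (sym shareOne) (eqᶠ-sym b b')) (eqᶠ-sym a a') ⟩
        (𝟙 (eqᶠ b' b) * ℓ₂ - 𝟙 (eqᶠ a' a) * ℓ₁) * δ ∎
        where
        shareOne = lineAdj⇒shareOne A a b a' b' adj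
      by-adjacency false ¬adj = begin
        c u e * gCoeff u e
          ≡⟨ cong (λ t → c u e * (if t then shareCoeff (eqᶠ b b') else + 0)) ¬adj ⟩
        c u e * + 0
          ≡⟨ *-zeroʳ (c u e) ⟩
        + 0
          ≡⟨ vanish (eqᶠ a a') (eqᶠ b b') shareBoth same-edge ⟨
        (𝟙 (eqᶠ b b') * ℓ₂ - 𝟙 (eqᶠ a a') * ℓ₁) * δ
          ≡⟨ cong₂ (λ s s' → (𝟙 s * ℓ₂ - 𝟙 s' * ℓ₁) * δ) (eqᶠ-sym b b') (eqᶠ-sym a a') ⟩
        (𝟙 (eqᶠ b' b) * ℓ₂ - 𝟙 (eqᶠ a' a) * ℓ₁) * δ ∎
        where
        shareBoth = ¬lineAdj⇒shareBothOrNone A a b a' b' Aab Aa'b' ¬adj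
        same-edge : eqᶠ a a' ≡ true → δ ≡ + 0
        same-edge a≟a' = trans (cong₂ (λ i j → φ (i , j) - φ u) (sym (eqᶠ⇒≡ a a' a≟a'))
                                                              (sym (eqᶠ⇒≡ b b' (trans shareBoth a≟a'))))
                               (+-inverseʳ (φ u))
        vanish : ∀ sa sb → sb ≡ sa → (sa ≡ true → δ ≡ + 0) → (𝟙 sb * ℓ₂ - 𝟙 sa * ℓ₁) * δ ≡ + 0
        vanish true  true  _ δ≡0 = trans (cong (k *_) (δ≡0 refl)) (*-zeroʳ k)
          where k = 𝟙 true * ℓ₂ - 𝟙 true * ℓ₁
        vanish false false _ _   = refl

    star-sum : ∀ {n} (π : Edge A → Fin n) (t : Fin n) (d : ℕ) →
      + d ≡ sumOf (λ e → 𝟙 (eqᶠ (π e) t)) (edges A) → ∀ u →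
      sumOf (λ e → 𝟙 (eqᶠ (π e) t) * (φ e - φ u)) (edges A) ≡ Φ π t - + d * φ u
    star-sum π t d deg u = trans (sumOf-*-shift (λ e → 𝟙 (eqᶠ (π e) t)) φ (φ u) (edges A))
                                 (cong (λ z → Φ π t - z * φ u) (sym deg))

    gAt-bond : ∀ a b → A a b ≡ true → gAt c (a , b) ≡ ψ (inj₂ b) - ψ (inj₁ a)
    gAt-bond a b Aab = begin
      gAt c u
        ≡⟨ sumOf-filterᵇ-cong _ (λ { (a' , b') Aa'b' → bond-term a b a' b' Aab Aa'b' })
                               (cartesianProduct (allFin p) (allFin q)) ⟩
      sumOf (λ e → (𝟙 (s₂ e) * ℓ₂ - 𝟙 (s₁ e) * ℓ₁) * δ e) (edges A)
        ≡⟨ sumOf-cong (λ e → split (𝟙 (s₂ e)) (𝟙 (s₁ e)) ℓ₁ ℓ₂ (δ e)) (edges A) ⟩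
      sumOf (λ e → ℓ₂ * (𝟙 (s₂ e) * δ e) - ℓ₁ * (𝟙 (s₁ e) * δ e)) (edges A)
        ≡⟨ sumOf-- _ _ (edges A) ⟩
      sumOf (λ e → ℓ₂ * (𝟙 (s₂ e) * δ e)) (edges A) - sumOf (λ e → ℓ₁ * (𝟙 (s₁ e) * δ e)) (edges A)
        ≡⟨ cong₂ _-_ (sumOf-*ˡ ℓ₂ _ (edges A)) (sumOf-*ˡ ℓ₁ _ (edges A)) ⟩
      ℓ₂ * sumOf (λ e → 𝟙 (s₂ e) * δ e) (edges A) - ℓ₁ * sumOf (λ e → 𝟙 (s₁ e) * δ e) (edges A)
        ≡⟨ cong₂ (λ x y → ℓ₂ * x - ℓ₁ * y) (star-sum proj₂ b d₂ deg-b u) (star-sum proj₁ a d₁ deg-a u) ⟩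
      ℓ₂ * (Φ proj₂ b - + d₂ * φ u) - ℓ₁ * (Φ proj₁ a - + d₁ * φ u)
        ≡⟨ rearrange ℓ₁ ℓ₂ (+ d₁) (+ d₂) (Φ proj₁ a) (Φ proj₂ b) (φ u) ⟩
      (ℓ₂ * Φ proj₂ b - ℓ₁ * Φ proj₁ a) + (ℓ₁ * + d₁ - ℓ₂ * + d₂) * φ u
        ≡⟨ cong (λ z → (ℓ₂ * Φ proj₂ b - ℓ₁ * Φ proj₁ a) + (z - ℓ₂ * + d₂) * φ u) ℓ₁d₁≡ℓ₂d₂ ⟩
      (ℓ₂ * Φ proj₂ b - ℓ₁ * Φ proj₁ a) + (ℓ₂ * + d₂ - ℓ₂ * + d₂) * φ u
        ≡⟨ cancel (ℓ₂ * Φ proj₂ b - ℓ₁ * Φ proj₁ a) (ℓ₂ * + d₂) (φ u) ⟩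
      ψ (inj₂ b) - ψ (inj₁ a) ∎
      where
      u = (a , b)
      s₁ s₂ : Edge A → Bool
      s₁ e = eqᶠ (proj₁ e) a
      s₂ e = eqᶠ (proj₂ e) b
      δ : Edge A → ℤ
      δ e = φ e - φ u
      deg-a : + d₁ ≡ sumOf (λ e → 𝟙 (s₁ e)) (edges A)
      deg-a = trans (cong +_ (sym (proj₁ regular a))) (deg₁-as-sum A a)
      deg-b : + d₂ ≡ sumOf (λ e → 𝟙 (s₂ e)) (edges A)
      deg-b = trans (cong +_ (sym (proj₂ regular b))) (deg₂-as-sum A b)
      split : ∀ i j l₁ l₂ x → (i * l₂ - j * l₁) * x ≡ l₂ * (i * x) - l₁ * (j * x)
      split = solve-∀
      rearrange : ∀ l₁ l₂ e₁ e₂ P₁ P₂ f →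
        l₂ * (P₂ - e₂ * f) - l₁ * (P₁ - e₁ * f) ≡ (l₂ * P₂ - l₁ * P₁) + (l₁ * e₁ - l₂ * e₂) * f
      rearrange = solve-∀
      cancel : ∀ x y f → x + (y - y) * f ≡ x
      cancel = solve-∀

    gMap-bond : InBond (bipGraph A) (gMap A d₁ d₂ c)
    gMap-bond = gMap-isChain c , ψ , on-edge
      where
      on-edge : ∀ x y → bipAdj A x y ≡ true → gMap A d₁ d₂ c x y ≡ ψ y - ψ x
      on-edge (inj₁ a) (inj₂ b) Aab = begin
        gMap A d₁ d₂ c (inj₁ a) (inj₂ b)   ≡⟨ gMap-on-edge c (proj₁ (proj₁ c-bond)) a b ⟩
        𝟙 (A a b) * gAt c (a , b)          ≡⟨ cong (λ t → 𝟙 t * gAt c (a , b)) Aab ⟩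
        + 1 * gAt c (a , b)                ≡⟨ *-identityˡ (gAt c (a , b)) ⟩
        gAt c (a , b)                      ≡⟨ gAt-bond a b Aab ⟩
        ψ (inj₂ b) - ψ (inj₁ a)            ∎
      on-edge (inj₂ b) (inj₁ a) Aab = begin
        gMap A d₁ d₂ c (inj₂ b) (inj₁ a)     ≡⟨ proj₁ (gMap-isChain c) (inj₂ b) (inj₁ a) ⟩
        - gMap A d₁ d₂ c (inj₁ a) (inj₂ b)   ≡⟨ cong -_ (on-edge (inj₁ a) (inj₂ b) Aab) ⟩
        - (ψ (inj₂ b) - ψ (inj₁ a))          ≡⟨ swap (ψ (inj₂ b)) (ψ (inj₁ a)) ⟩
        ψ (inj₁ a) - ψ (inj₂ b)              ∎
        where
        swap : ∀ x y → - (x - y) ≡ y - x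
        swap = solve-∀

proposition8p3 : (p q : ℕ) (A : BiAdj p q) (d₁ d₂ : ℕ) .{{_ : NonZero d₁}} .{{_ : NonZero d₂}} →
    Semiregular A d₁ d₂ →
      ((c c' : Chain (lineGraph A)) → ∀ x y →
          gMap A d₁ d₂ (λ e e' → c e e' + c' e e') x y ≡ gMap A d₁ d₂ c x y + gMap A d₁ d₂ c' x y)
      × ((c : Chain (lineGraph A)) → IsChain (lineGraph A) c → IsChain (bipGraph A) (gMap A d₁ d₂ c))
      × ((c : Chain (lineGraph A)) → InBond (lineGraph A) c → InBond (bipGraph A) (gMap A d₁ d₂ c))
      × ((c : Chain (lineGraph A)) → InCycle (lineGraph A) c → InCycle (bipGraph A) (gMap A d₁ d₂ c))
      × ((c : Chain (lineGraph A)) → InBondPlusCycle (lineGraph A) c →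
           InBondPlusCycle (bipGraph A) (gMap A d₁ d₂ c))
proposition8p3 p q A d₁ d₂ regular =
  gMap-+ A d₁ d₂ , (λ c _ → gMap-isChain A d₁ d₂ c) , bond , cycle , bond+cycle
  where
  bond : (c : Chain (lineGraph A)) → InBond (lineGraph A) c → InBond (bipGraph A) (gMap A d₁ d₂ c)
  bond = gMap-bond A d₁ d₂ regular
  cycle : (c : Chain (lineGraph A)) → InCycle (lineGraph A) c → InCycle (bipGraph A) (gMap A d₁ d₂ c)
  cycle = gMap-cycle A d₁ d₂
  bond+cycle : (c : Chain (lineGraph A)) → InBondPlusCycle (lineGraph A) c →
               InBondPlusCycle (bipGraph A) (gMap A d₁ d₂ c)
  bond+cycle c (b , z , b-bond , z-cycle , c≡b+z) =
    gMap A d₁ d₂ b , gMap A d₁ d₂ z , bond b b-bond , cycle z z-cycle ,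
    λ x y → trans (gMap-cong A d₁ d₂ c _ c≡b+z x y) (gMap-+ A d₁ d₂ b z x y)
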